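{- Let $G$ be a finite connected simple graph on vertex set $\{1,\dots,n\}$. Suppose a terminating chip-firing game with $N$ chips was played on $G$ and let $s$ be the total number of firings. Then $s \leq 2nNf$, where $f=\max_{1\le i\le n} L^{\dagger}_{ii}$.
   Context: Chip-firing game: a configuration is a vector $\mathbf a\in\mathbb Z_{\ge 0}^n$ ($a_i$ chips on vertex $i$), with $N=\sum_i a_i$ chips. Vertex $i$ of degree $d_i$ may fire if $a_i\ge d_i$; firing moves one chip from $i$ to each neighbour of $i$. A terminating game is a finite sequence of legal firings from an initial configuration ending in a configuration in which no vertex can fire; $s$ is the length of this sequence. $L$ is the Laplacian of $G$ ($L_{ii}=d_i$, $L_{ij}=-1$ for adjacent $i\neq j$, $0$ otherwise) and $L^{\dagger}$ its Moore–Penrose pseudo-inverse. -}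

module Defs where

open import Data.Nat as ℕ using (ℕ; zero; suc)
open import Data.Fin using (Fin; zero; suc; _≟_)
open import Data.Bool using (Bool; true; false; if_then_else_)
open import Data.List using (List; []; _∷_)
open import Data.Integer using (+_; -[1+_])
open import Data.Rational as ℚ using (ℚ; 0ℚ; 1ℚ; _/_)
open import Relation.Nullary using (does)
open import Relation.Binary.PropositionalEquality using (_≡_)
open import Data.Product using (∃-syntax; _×_; _,_)

sumℕ : ∀ {n} → (Fin n → ℕ) → ℕ
sumℕ {zero}  f = 0
sumℕ {suc n} f = f zero ℕ.+ sumℕ (λ i → f (suc i))

sumℚ : ∀ {n} → (Fin n → ℚ) → ℚ
sumℚ {zero}  f = 0ℚ
sumℚ {suc n} f = f zero ℚ.+ sumℚ (λ i → f (suc i))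

record SimpleGraph (n : ℕ) : Set where
  field
    adj       : Fin n → Fin n → Bool
    symmetric : ∀ i j → adj i j ≡ adj j i
    loopless  : ∀ i → adj i i ≡ false

open SimpleGraph public

data Reachable {n} (G : SimpleGraph n) : Fin n → Fin n → Set where
  here : ∀ {i} → Reachable G i i
  step : ∀ {i j k} → adj G i j ≡ true → Reachable G j k → Reachable G i k

Connected : ∀ {n} → SimpleGraph n → Set
Connected {n} G = ∀ (i j : Fin n) → Reachable G i j

deg : ∀ {n} → SimpleGraph n → Fin n → ℕ
deg G i = sumℕ (λ j → if adj G i j then 1 else 0)

Config : ℕ → Set
Config n = Fin n → ℕ

chips : ∀ {n} → Config n → ℕ
chips a = sumℕ a

fire : ∀ {n} → SimpleGraph n → Fin n → Config n → Config n
fire G i a j =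
  if does (j ≟ i) then a j ℕ.∸ deg G i
  else (if adj G i j then suc (a j) else a j)

Stable : ∀ {n} → SimpleGraph n → Config n → Set
Stable G a = ∀ i → a i ℕ.< deg G i

data Legal {n} (G : SimpleGraph n) : Config n → List (Fin n) → Config n → Set where
  done : ∀ {a} → Legal G a [] a
  fireStep : ∀ {a b i is} → deg G i ℕ.≤ a i → Legal G (fire G i a) is b → Legal G a (i ∷ is) b

TerminatingGame : ∀ {n} → SimpleGraph n → Config n → List (Fin n) → Set
TerminatingGame G a is = ∃[ b ] (Legal G a is b × Stable G b)

Matrix : ℕ → Set
Matrix n = Fin n → Fin n → ℚ

_⊗_ : ∀ {n} → Matrix n → Matrix n → Matrix n
(A ⊗ B) i j = sumℚ (λ k → A i k ℚ.* B k j)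

transpose : ∀ {n} → Matrix n → Matrix n
transpose A i j = A j i

laplacian : ∀ {n} → SimpleGraph n → Matrix n
laplacian G i j =
  if does (i ≟ j) then (+ deg G i) / 1
  else (if adj G i j then -[1+ 0 ] / 1 else 0ℚ)

-- Moore–Penrose pseudo-inverse (Penrose conditions; over ℚ transpose = conjugate transpose)
IsMoorePenroseInverse : ∀ {n} → Matrix n → Matrix n → Set
IsMoorePenroseInverse A M =
  (∀ i j → ((A ⊗ M) ⊗ A) i j ≡ A i j) ×
  (∀ i j → ((M ⊗ A) ⊗ M) i j ≡ M i j) ×
  (∀ i j → transpose (A ⊗ M) i j ≡ (A ⊗ M) i j) ×
  (∀ i j → transpose (M ⊗ A) i j ≡ (M ⊗ A) i j)

IsMaxDiag : ∀ {n} → Matrix n → ℚ → Set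
IsMaxDiag {n} M f = (∃[ i ] M i i ≡ f) × (∀ (i : Fin n) → M i i ℚ.≤ f)

module Submission where

-- Let x be the firing vector (x j = number of firings of j) and a, b the initial
-- and final configurations.  Conservation of chips reads L x = a − b, and in a
-- terminating game some vertex k never fires, x k = 0.  Since L P L = L, the
-- vector x − P L x is harmonic, hence constant on the connected graph; as the
-- entries of P v always sum to zero, this gives  s = Σ x = n · (−(P (a − b)) k).
-- As L is symmetric positive semidefinite, every entry of P is bounded by f in
-- absolute value, so  −(P (a − b)) k ≤ f (Σ a + Σ b) = 2 N f.

open import Defs

module ChipFiringBound where

  open import Data.Nat as ℕ using (ℕ; zero; suc)
  import Data.Nat.Properties as ℕP
  open import Data.Nat.Coprimality using (1-coprimeTo) renaming (sym to coprime-sym)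
  import Data.Integer as ℤ
  import Data.Integer.Properties as ℤP
  open import Data.Rational
    using (ℚ; mkℚ; 0ℚ; 1ℚ; _+_; _-_; -_; _*_; _≤_; _/_; *≤*; nonNegative; nonPositive)
  import Data.Rational.Properties as ℚP
  open import Data.Rational.Solver using (module +-*-Solver)
  open import Data.Fin using (Fin; zero; suc; _≟_)
  import Data.Fin.Properties as FinP
  open import Data.Bool using (true; false; if_then_else_)
  open import Data.List using (List; []; _∷_; length; allFin)
  import Data.List.Relation.Unary.All as All
  open import Data.List.Membership.Propositional.Properties using (∈-allFin)
  open import Data.Product using (_×_; _,_; ∃-syntax; proj₁; proj₂)
  open import Data.Empty using (⊥-elim)
  open import Function using (_∘_)
  open import Algebra.Bundles using (CommutativeRing)
  import Algebra.Properties.Group as GroupProperties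
  import Algebra.Properties.Semiring.Sum as SemiringSum
  open import Relation.Binary.Bundles using (Setoid; DecTotalOrder)
  import Relation.Binary.Reasoning.Setoid as SetoidReasoning
  open import Relation.Binary.PropositionalEquality
  open import Relation.Nullary using (does; yes; no; ¬?)
  open import Relation.Nullary.Decidable using (_×-dec_)
  open import Data.List.Extrema (DecTotalOrder.totalOrder ℚP.≤-decTotalOrder)
    using (argmax; f[xs]≤f[argmax])

  open +-*-Solver using (solve; _:+_; _:-_; _:*_; :-_; _:=_; con)

  ι : ℕ → ℚ
  ι m = (ℤ.+ m) / 1

  -- ι m written as a normalised rational, to compute with numerator/denominator.
  ι-normal : ∀ m → ι m ≡ mkℚ (ℤ.+ m) 0 (coprime-sym (1-coprimeTo m))
  ι-normal m = ℚP.normalize-coprime _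

  ι-+ : ∀ m k → ι (m ℕ.+ k) ≡ ι m + ι k
  ι-+ m k = trans (ℚP./-cong {p₂ = ℤ.+ m ℤ.* ℤ.+ 1 ℤ.+ ℤ.+ k ℤ.* ℤ.+ 1} eq refl)
                  (sym (cong₂ _+_ (ι-normal m) (ι-normal k)))
    where eq = cong₂ ℤ._+_ (sym (ℤP.*-identityʳ (ℤ.+ m))) (sym (ℤP.*-identityʳ (ℤ.+ k)))

  ι-* : ∀ m k → ι (m ℕ.* k) ≡ ι m * ι k
  ι-* m k = trans (ℚP./-cong {p₂ = ℤ.+ m ℤ.* ℤ.+ k} (ℤP.pos-* m k) refl)
                  (sym (cong₂ _*_ (ι-normal m) (ι-normal k)))

  ι-mono : ∀ {m k} → m ℕ.≤ k → ι m ≤ ι k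
  ι-mono {m} {k} m≤k rewrite ι-normal m | ι-normal k = *≤* (ℤP.*-monoʳ-≤-nonNeg (ℤ.+ 1) (ℤ.+≤+ m≤k))

  ι-cancel-≤ : ∀ {m k} → ι m ≤ ι k → m ℕ.≤ k
  ι-cancel-≤ {m} {k} ιm≤ιk rewrite ι-normal m | ι-normal k with ιm≤ιk
  ... | *≤* m*1≤k*1 = ℤP.drop‿+≤+ (subst₂ ℤ._≤_ (ℤP.*-identityʳ (ℤ.+ m)) (ℤP.*-identityʳ (ℤ.+ k)) m*1≤k*1)

  ι-nonneg : ∀ m → 0ℚ ≤ ι m
  ι-nonneg m = ι-mono {0} {m} ℕ.z≤n

  0≤-⇒≤ : ∀ {x y} → 0ℚ ≤ y - x → x ≤ y
  0≤-⇒≤ {x} {y} 0≤y-x = subst₂ _≤_ (ℚP.+-identityʳ x) (solve 2 (λ x y → x :+ (y :- x) := y) refl x y)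
                                    (ℚP.+-monoʳ-≤ x 0≤y-x)

  ≤⇒0≤- : ∀ {x y} → x ≤ y → 0ℚ ≤ y - x
  ≤⇒0≤- {x} {y} x≤y = subst (_≤ y - x) (ℚP.+-inverseʳ x) (ℚP.+-monoˡ-≤ (- x) x≤y)

  -≡0⇒≡ : ∀ {x y} → x - y ≡ 0ℚ → x ≡ y
  -≡0⇒≡ {x} {y} = GroupProperties.x∙y⁻¹≈ε⇒x≈y ℚP.+-0-group x y

  halve-nonneg : ∀ {x} → 0ℚ ≤ x + x → 0ℚ ≤ x
  halve-nonneg {x} 0≤2x with 0ℚ ℚP.≤? x
  ... | yes 0≤x = 0≤x
  ... | no 0≰x = ⊥-elim (ℚP.<-irrefl refl (ℚP.<-≤-trans (ℚP.+-mono-< x<0 x<0) 0≤2x))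
    where x<0 = ℚP.≰⇒> 0≰x

  square-nonneg : ∀ x → 0ℚ ≤ x * x
  square-nonneg x with 0ℚ ℚP.≤? x
  ... | yes 0≤x = ℚP.nonNegative⁻¹ _ {{ℚP.nonNeg*nonNeg⇒nonNeg x {{nonNegative 0≤x}} x {{nonNegative 0≤x}}}}
  ... | no 0≰x = ℚP.nonNegative⁻¹ _ {{ℚP.nonPos*nonPos⇒nonPos x {{x≤0}} x {{x≤0}}}}
    where x≤0 = nonPositive (ℚP.<⇒≤ (ℚP.≰⇒> 0≰x))

  -- Finite sums.  The defining recursion of sumℚ agrees with the library's
  -- Vector sum, whose algebraic laws we transport.
  module Σ = SemiringSum (CommutativeRing.semiring ℚP.+-*-commutativeRing)

  sumℚ≡sum : ∀ {n} (f : Fin n → ℚ) → sumℚ f ≡ Σ.sum f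
  sumℚ≡sum {zero}  f = refl
  sumℚ≡sum {suc n} f = cong (f zero +_) (sumℚ≡sum (λ i → f (suc i)))

  sumℚ-cong : ∀ {n} {f g : Fin n → ℚ} → (∀ i → f i ≡ g i) → sumℚ f ≡ sumℚ g
  sumℚ-cong {n} {f} {g} f≗g = trans (sumℚ≡sum f) (trans (Σ.sum-cong-≗ f≗g) (sym (sumℚ≡sum g)))

  sumℚ-zero : ∀ {n} → sumℚ {n} (λ _ → 0ℚ) ≡ 0ℚ
  sumℚ-zero {n} = trans (sumℚ≡sum {n} (λ _ → 0ℚ)) (Σ.sum-replicate-zero n)

  sumℚ-+ : ∀ {n} (f g : Fin n → ℚ) → sumℚ (λ i → f i + g i) ≡ sumℚ f + sumℚ g
  sumℚ-+ f g = begin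
    sumℚ (λ i → f i + g i)    ≡⟨ sumℚ≡sum (λ i → f i + g i) ⟩
    Σ.sum (λ i → f i + g i)   ≡⟨ Σ.∑-distrib-+ f g ⟩
    Σ.sum f + Σ.sum g         ≡⟨ cong₂ _+_ (sumℚ≡sum f) (sumℚ≡sum g) ⟨
    sumℚ f + sumℚ g           ∎
    where open ≡-Reasoning

  sumℚ-*ˡ : ∀ {n} (c : ℚ) (f : Fin n → ℚ) → sumℚ (λ i → c * f i) ≡ c * sumℚ f
  sumℚ-*ˡ c f = begin
    sumℚ (λ i → c * f i)   ≡⟨ sumℚ≡sum (λ i → c * f i) ⟩
    Σ.sum (λ i → c * f i)  ≡⟨ Σ.*-distribˡ-sum c f ⟨
    c * Σ.sum f            ≡⟨ cong (c *_) (sumℚ≡sum f) ⟨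
    c * sumℚ f             ∎
    where open ≡-Reasoning

  sumℚ-*ʳ : ∀ {n} (c : ℚ) (f : Fin n → ℚ) → sumℚ (λ i → f i * c) ≡ sumℚ f * c
  sumℚ-*ʳ c f = trans (sumℚ-cong (λ i → ℚP.*-comm (f i) c)) (trans (sumℚ-*ˡ c f) (ℚP.*-comm c _))

  sumℚ-swap : ∀ {m n} (g : Fin m → Fin n → ℚ) →
              sumℚ (λ i → sumℚ (λ j → g i j)) ≡ sumℚ (λ j → sumℚ (λ i → g i j))
  sumℚ-swap g = begin
    sumℚ (λ i → sumℚ (g i))                     ≡⟨ sumℚ≡sum (λ i → sumℚ (g i)) ⟩
    Σ.sum (λ i → sumℚ (g i))                    ≡⟨ Σ.sum-cong-≗ (λ i → sumℚ≡sum (g i)) ⟩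
    Σ.sum (λ i → Σ.sum (g i))                   ≡⟨ Σ.∑-comm g ⟩
    Σ.sum (λ j → Σ.sum (λ i → g i j))           ≡⟨ Σ.sum-cong-≗ (λ j → sumℚ≡sum (λ i → g i j)) ⟨
    Σ.sum (λ j → sumℚ (λ i → g i j))            ≡⟨ sumℚ≡sum (λ j → sumℚ (λ i → g i j)) ⟨
    sumℚ (λ j → sumℚ (λ i → g i j))             ∎
    where open ≡-Reasoning

  sumℚ-neg : ∀ {n} (f : Fin n → ℚ) → sumℚ (λ i → - f i) ≡ - sumℚ f
  sumℚ-neg {zero}  f = refl
  sumℚ-neg {suc n} f = trans (cong (- f zero +_) (sumℚ-neg (λ i → f (suc i))))
                             (sym (ℚP.neg-distrib-+ (f zero) _))

  sumℚ-- : ∀ {n} (f g : Fin n → ℚ) → sumℚ (λ i → f i - g i) ≡ sumℚ f - sumℚ g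
  sumℚ-- f g = trans (sumℚ-+ f (λ i → - g i)) (cong (sumℚ f +_) (sumℚ-neg g))

  sumℚ-const : ∀ {n} (c : ℚ) → sumℚ {n} (λ _ → c) ≡ ι n * c
  sumℚ-const {zero}  c = sym (ℚP.*-zeroˡ c)
  sumℚ-const {suc n} c = begin
    c + sumℚ {n} (λ _ → c)  ≡⟨ cong (c +_) (sumℚ-const {n} c) ⟩
    c + ι n * c             ≡⟨ solve 2 (λ c m → c :+ m :* c := (con 1ℚ :+ m) :* c) refl c (ι n) ⟩
    (1ℚ + ι n) * c          ≡⟨ cong (_* c) (ι-+ 1 n) ⟨
    ι (suc n) * c           ∎
    where open ≡-Reasoning

  sumℚ-select : ∀ {n} (i : Fin n) (g : Fin n → ℚ) → sumℚ (λ j → if does (i ≟ j) then g j else 0ℚ) ≡ g i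
  sumℚ-select {suc n} zero    g = trans (cong (g zero +_) (sumℚ-zero {n})) (ℚP.+-identityʳ (g zero))
  sumℚ-select {suc n} (suc i) g = trans (ℚP.+-identityˡ _)
                                        (trans (sumℚ-cong pointwise) (sumℚ-select i (λ j → g (suc j))))
    where pointwise : ∀ j → (if does (suc i ≟ suc j) then g (suc j) else 0ℚ)
                            ≡ (if does (i ≟ j) then g (suc j) else 0ℚ)
          pointwise j with i ≟ j
          ... | yes _ = refl
          ... | no  _ = refl

  sumℚ-mono : ∀ {n} {f g : Fin n → ℚ} → (∀ i → f i ≤ g i) → sumℚ f ≤ sumℚ g
  sumℚ-mono {zero}  f≤g = ℚP.≤-refl
  sumℚ-mono {suc n} f≤g = ℚP.+-mono-≤ (f≤g zero) (sumℚ-mono (λ i → f≤g (suc i)))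

  sumℚ-nonneg : ∀ {n} {f : Fin n → ℚ} → (∀ i → 0ℚ ≤ f i) → 0ℚ ≤ sumℚ f
  sumℚ-nonneg {n} {f} 0≤f = subst (_≤ sumℚ f) (sumℚ-zero {n}) (sumℚ-mono 0≤f)

  sumℚ-nonneg-zero : ∀ {n} {f : Fin n → ℚ} → (∀ i → 0ℚ ≤ f i) → sumℚ f ≡ 0ℚ → ∀ i → f i ≡ 0ℚ
  sumℚ-nonneg-zero {suc n} {f} 0≤f Σf≡0 = pointwise
    where
      0≤rest = sumℚ-nonneg (λ i → 0≤f (suc i))
      head≤0 : f zero ≤ 0ℚ
      head≤0 = subst₂ _≤_ (ℚP.+-identityʳ (f zero)) Σf≡0 (ℚP.+-monoʳ-≤ (f zero) 0≤rest)
      rest≤0 : sumℚ (λ i → f (suc i)) ≤ 0ℚ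
      rest≤0 = subst₂ _≤_ (ℚP.+-identityˡ _) Σf≡0 (ℚP.+-monoˡ-≤ _ (0≤f zero))
      pointwise : ∀ i → f i ≡ 0ℚ
      pointwise zero    = ℚP.≤-antisym head≤0 (0≤f zero)
      pointwise (suc i) = sumℚ-nonneg-zero (λ i → 0≤f (suc i)) (ℚP.≤-antisym rest≤0 0≤rest) i

  ι-sum : ∀ {n} (f : Fin n → ℕ) → ι (sumℕ f) ≡ sumℚ (λ i → ι (f i))
  ι-sum {zero}  f = refl
  ι-sum {suc n} f = trans (ι-+ (f zero) _) (cong (ι (f zero) +_) (ι-sum (λ i → f (suc i))))

  infix 4 _≈ₘ_
  _≈ₘ_ : ∀ {n} → Matrix n → Matrix n → Set
  A ≈ₘ B = ∀ i j → A i j ≡ B i j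

  matrixSetoid : ℕ → Setoid _ _
  matrixSetoid n = record
    { Carrier = Matrix n
    ; _≈_ = _≈ₘ_
    ; isEquivalence = record
      { refl = λ i j → refl
      ; sym = λ A≈B i j → sym (A≈B i j)
      ; trans = λ A≈B B≈C i j → trans (A≈B i j) (B≈C i j)
      }
    }

  infix 25 _ᵀ
  _ᵀ : ∀ {n} → Matrix n → Matrix n
  A ᵀ = transpose A

  infixl 7 _·_
  _·_ : ∀ {n} → Matrix n → (Fin n → ℚ) → Fin n → ℚ
  (A · v) i = sumℚ (λ j → A i j * v j)

  unitVector : ∀ {n} → Fin n → Fin n → ℚ
  unitVector i j = if does (i ≟ j) then 1ℚ else 0ℚ

  -- The j-th column of a matrix; note (A ⊗ B) i j = (A · col B j) i by definition.
  col : ∀ {n} → Matrix n → Fin n → Fin n → ℚ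
  col B j k = B k j

  module _ {n : ℕ} where

    ⊗-cong : {A A′ B B′ : Matrix n} → A ≈ₘ A′ → B ≈ₘ B′ → A ⊗ B ≈ₘ A′ ⊗ B′
    ⊗-cong A≈A′ B≈B′ i j = sumℚ-cong (λ k → cong₂ _*_ (A≈A′ i k) (B≈B′ k j))

    ⊗-congˡ : (A : Matrix n) {B B′ : Matrix n} → B ≈ₘ B′ → A ⊗ B ≈ₘ A ⊗ B′
    ⊗-congˡ A = ⊗-cong {A = A} (λ _ _ → refl)

    ⊗-congʳ : (B : Matrix n) {A A′ : Matrix n} → A ≈ₘ A′ → A ⊗ B ≈ₘ A′ ⊗ B
    ⊗-congʳ B A≈A′ = ⊗-cong {B = B} A≈A′ (λ _ _ → refl)

    transpose-cong : {A B : Matrix n} → A ≈ₘ B → A ᵀ ≈ₘ B ᵀ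
    transpose-cong A≈B i j = A≈B j i

    transpose-⊗ : (A B : Matrix n) → (A ⊗ B) ᵀ ≈ₘ B ᵀ ⊗ A ᵀ
    transpose-⊗ A B i j = sumℚ-cong (λ k → ℚP.*-comm (A j k) (B k i))

    ·-⊗ : (A B : Matrix n) (v : Fin n → ℚ) → ∀ i → (A · (B · v)) i ≡ ((A ⊗ B) · v) i
    ·-⊗ A B v i = begin
      sumℚ (λ j → A i j * sumℚ (λ k → B j k * v k))   ≡⟨ sumℚ-cong (λ j → sym (sumℚ-*ˡ (A i j) (λ k → B j k * v k))) ⟩
      sumℚ (λ j → sumℚ (λ k → A i j * (B j k * v k))) ≡⟨ sumℚ-swap (λ j k → A i j * (B j k * v k)) ⟩
      sumℚ (λ k → sumℚ (λ j → A i j * (B j k * v k))) ≡⟨ sumℚ-cong (λ k → sumℚ-cong (λ j → sym (ℚP.*-assoc (A i j) (B j k) (v k)))) ⟩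
      sumℚ (λ k → sumℚ (λ j → A i j * B j k * v k))   ≡⟨ sumℚ-cong (λ k → sumℚ-*ʳ (v k) (λ j → A i j * B j k)) ⟩
      sumℚ (λ k → (A ⊗ B) i k * v k)                  ∎
      where open ≡-Reasoning

    ⊗-assoc : (A B C : Matrix n) → (A ⊗ B) ⊗ C ≈ₘ A ⊗ (B ⊗ C)
    ⊗-assoc A B C i j = sym (·-⊗ A B (col C j) i)

    ·-cong : (A : Matrix n) {v w : Fin n → ℚ} → (∀ j → v j ≡ w j) → ∀ i → (A · v) i ≡ (A · w) i
    ·-cong A v≗w i = sumℚ-cong (λ j → cong (A i j *_) (v≗w j))

    ·-+ : (A : Matrix n) (v w : Fin n → ℚ) → ∀ i → (A · (λ j → v j + w j)) i ≡ (A · v) i + (A · w) i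
    ·-+ A v w i = trans (sumℚ-cong (λ j → ℚP.*-distribˡ-+ (A i j) (v j) (w j)))
                        (sumℚ-+ (λ j → A i j * v j) (λ j → A i j * w j))

    ·-linear : (A : Matrix n) (v w : Fin n → ℚ) (s : ℚ) →
               ∀ i → (A · (λ j → v j + s * w j)) i ≡ (A · v) i + s * (A · w) i
    ·-linear A v w s i = begin
      sumℚ (λ j → A i j * (v j + s * w j))              ≡⟨ sumℚ-cong (λ j → distribute (A i j) (v j) (w j)) ⟩
      sumℚ (λ j → A i j * v j + s * (A i j * w j))      ≡⟨ sumℚ-+ (λ j → A i j * v j) (λ j → s * (A i j * w j)) ⟩
      (A · v) i + sumℚ (λ j → s * (A i j * w j))        ≡⟨ cong ((A · v) i +_) (sumℚ-*ˡ s (λ j → A i j * w j)) ⟩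
      (A · v) i + s * (A · w) i                         ∎
      where
        open ≡-Reasoning
        distribute : ∀ a x y → a * (x + s * y) ≡ a * x + s * (a * y)
        distribute a x y = solve 4 (λ a x y s → a :* (x :+ s :* y) := a :* x :+ s :* (a :* y)) refl a x y s

    ·-sub : (A : Matrix n) (v w : Fin n → ℚ) → ∀ i → (A · (λ j → v j - w j)) i ≡ (A · v) i - (A · w) i
    ·-sub A v w i = trans (sumℚ-cong (λ j → distribute (A i j) (v j) (w j))) (sumℚ-- (λ j → A i j * v j) (λ j → A i j * w j))
      where distribute : ∀ a x y → a * (x - y) ≡ a * x - a * y
            distribute = solve 3 (λ a x y → a :* (x :- y) := a :* x :- a :* y) refl

    ·-unit : (A : Matrix n) (i : Fin n) → ∀ u → (A · unitVector i) u ≡ A u i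
    ·-unit A i u = trans (sumℚ-cong select) (sumℚ-select i (A u))
      where select : ∀ j → A u j * unitVector i j ≡ (if does (i ≟ j) then A u j else 0ℚ)
            select j with i ≟ j
            ... | yes _ = ℚP.*-identityʳ (A u j)
            ... | no  _ = ℚP.*-zeroʳ (A u j)

    ZeroColumnSums : Matrix n → Set
    ZeroColumnSums A = ∀ k → sumℚ (λ i → A i k) ≡ 0ℚ

    sum-·-zero : {A : Matrix n} → ZeroColumnSums A → ∀ v → sumℚ (A · v) ≡ 0ℚ
    sum-·-zero {A} colA v = begin
      sumℚ (λ i → sumℚ (λ k → A i k * v k))   ≡⟨ sumℚ-swap (λ i k → A i k * v k) ⟩
      sumℚ (λ k → sumℚ (λ i → A i k * v k))   ≡⟨ sumℚ-cong (λ k → sumℚ-*ʳ (v k) (λ i → A i k)) ⟩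
      sumℚ (λ k → sumℚ (λ i → A i k) * v k)   ≡⟨ sumℚ-cong (λ k → trans (cong (_* v k) (colA k)) (ℚP.*-zeroˡ (v k))) ⟩
      sumℚ {n} (λ _ → 0ℚ)                     ≡⟨ sumℚ-zero {n} ⟩
      0ℚ                                      ∎
      where open ≡-Reasoning

  module _ {n : ℕ} where

    open SetoidReasoning (matrixSetoid n)

    mp-unique : {A X Y : Matrix n} → IsMoorePenroseInverse A X → IsMoorePenroseInverse A Y → X ≈ₘ Y
    mp-unique {A} {X} {Y} (x₁ , x₂ , x₃ , x₄) (y₁ , y₂ , y₃ , y₄) = begin
      X                    ≈⟨ x₂ ⟨
      (X ⊗ A) ⊗ X          ≈⟨ ⊗-assoc X A X ⟩
      X ⊗ (A ⊗ X)          ≈⟨ ⊗-congˡ X AX≈AY ⟩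
      X ⊗ (A ⊗ Y)          ≈⟨ ⊗-assoc X A Y ⟨
      (X ⊗ A) ⊗ Y          ≈⟨ ⊗-congʳ Y XA≈YA ⟩
      (Y ⊗ A) ⊗ Y          ≈⟨ y₂ ⟩
      Y                    ∎
      where
        AX≈AY : A ⊗ X ≈ₘ A ⊗ Y
        AX≈AY = begin
          A ⊗ X                        ≈⟨ ⊗-congʳ X y₁ ⟨
          ((A ⊗ Y) ⊗ A) ⊗ X            ≈⟨ ⊗-assoc (A ⊗ Y) A X ⟩
          (A ⊗ Y) ⊗ (A ⊗ X)            ≈⟨ ⊗-cong y₃ x₃ ⟨
          (A ⊗ Y) ᵀ ⊗ (A ⊗ X) ᵀ        ≈⟨ ⊗-congʳ ((A ⊗ X) ᵀ) (transpose-⊗ A Y) ⟩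
          (Y ᵀ ⊗ A ᵀ) ⊗ (A ⊗ X) ᵀ      ≈⟨ ⊗-assoc (Y ᵀ) (A ᵀ) ((A ⊗ X) ᵀ) ⟩
          Y ᵀ ⊗ (A ᵀ ⊗ (A ⊗ X) ᵀ)      ≈⟨ ⊗-congˡ (Y ᵀ) (transpose-⊗ (A ⊗ X) A) ⟨
          Y ᵀ ⊗ ((A ⊗ X) ⊗ A) ᵀ        ≈⟨ ⊗-congˡ (Y ᵀ) (transpose-cong x₁) ⟩
          Y ᵀ ⊗ A ᵀ                    ≈⟨ transpose-⊗ A Y ⟨
          (A ⊗ Y) ᵀ                    ≈⟨ y₃ ⟩
          A ⊗ Y                        ∎
        XA≈YA : X ⊗ A ≈ₘ Y ⊗ A
        XA≈YA = begin
          X ⊗ A                        ≈⟨ ⊗-congˡ X y₁ ⟨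
          X ⊗ ((A ⊗ Y) ⊗ A)            ≈⟨ ⊗-congˡ X (⊗-assoc A Y A) ⟩
          X ⊗ (A ⊗ (Y ⊗ A))            ≈⟨ ⊗-assoc X A (Y ⊗ A) ⟨
          (X ⊗ A) ⊗ (Y ⊗ A)            ≈⟨ ⊗-cong x₄ y₄ ⟨
          (X ⊗ A) ᵀ ⊗ (Y ⊗ A) ᵀ        ≈⟨ ⊗-congˡ ((X ⊗ A) ᵀ) (transpose-⊗ Y A) ⟩
          (X ⊗ A) ᵀ ⊗ (A ᵀ ⊗ Y ᵀ)      ≈⟨ ⊗-assoc ((X ⊗ A) ᵀ) (A ᵀ) (Y ᵀ) ⟨
          ((X ⊗ A) ᵀ ⊗ A ᵀ) ⊗ Y ᵀ      ≈⟨ ⊗-congʳ (Y ᵀ) (transpose-⊗ A (X ⊗ A)) ⟨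
          (A ⊗ (X ⊗ A)) ᵀ ⊗ Y ᵀ        ≈⟨ ⊗-congʳ (Y ᵀ) (transpose-cong (⊗-assoc A X A)) ⟨
          ((A ⊗ X) ⊗ A) ᵀ ⊗ Y ᵀ        ≈⟨ ⊗-congʳ (Y ᵀ) (transpose-cong x₁) ⟩
          A ᵀ ⊗ Y ᵀ                    ≈⟨ transpose-⊗ Y A ⟨
          (Y ⊗ A) ᵀ                    ≈⟨ y₄ ⟩
          Y ⊗ A                        ∎

    transpose-sandwich : {A P : Matrix n} → (A ⊗ P) ⊗ A ≈ₘ A → (A ᵀ ⊗ P ᵀ) ⊗ A ᵀ ≈ₘ A ᵀ
    transpose-sandwich {A} {P} APA≈A = begin
      (A ᵀ ⊗ P ᵀ) ⊗ A ᵀ    ≈⟨ ⊗-congʳ (A ᵀ) (transpose-⊗ P A) ⟨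
      (P ⊗ A) ᵀ ⊗ A ᵀ      ≈⟨ transpose-⊗ A (P ⊗ A) ⟨
      (A ⊗ (P ⊗ A)) ᵀ      ≈⟨ transpose-cong (⊗-assoc A P A) ⟨
      ((A ⊗ P) ⊗ A) ᵀ      ≈⟨ transpose-cong APA≈A ⟩
      A ᵀ                  ∎

    transpose-selfAdjoint : {A P : Matrix n} → (P ⊗ A) ᵀ ≈ₘ P ⊗ A → (A ᵀ ⊗ P ᵀ) ᵀ ≈ₘ A ᵀ ⊗ P ᵀ
    transpose-selfAdjoint {A} {P} PA-sym = begin
      (A ᵀ ⊗ P ᵀ) ᵀ        ≈⟨ transpose-⊗ (A ᵀ) (P ᵀ) ⟩
      P ⊗ A                ≈⟨ PA-sym ⟨
      (P ⊗ A) ᵀ            ≈⟨ transpose-⊗ P A ⟩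
      A ᵀ ⊗ P ᵀ            ∎

    mp-transpose : {A P : Matrix n} → IsMoorePenroseInverse A P → IsMoorePenroseInverse (A ᵀ) (P ᵀ)
    mp-transpose {A} {P} (p₁ , p₂ , p₃ , p₄) =
      transpose-sandwich {A} {P} p₁ , transpose-sandwich {P} {A} p₂ ,
      transpose-selfAdjoint {A} {P} p₄ , transpose-selfAdjoint {P} {A} p₃

    mp-resp : {A B P : Matrix n} → A ≈ₘ B → IsMoorePenroseInverse A P → IsMoorePenroseInverse B P
    mp-resp {A} {B} {P} A≈B (p₁ , p₂ , p₃ , p₄) =
      (λ i j → trans (sym (⊗-cong (⊗-congʳ P A≈B) A≈B i j)) (trans (p₁ i j) (A≈B i j))) ,
      (λ i j → trans (sym (⊗-congʳ P (⊗-congˡ P A≈B) i j)) (p₂ i j)) ,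
      (λ i j → trans (sym (⊗-congʳ P A≈B j i)) (trans (p₃ i j) (⊗-congʳ P A≈B i j))) ,
      (λ i j → trans (sym (⊗-congˡ P A≈B j i)) (trans (p₄ i j) (⊗-congˡ P A≈B i j)))

    mp-symmetric : {A P : Matrix n} → A ᵀ ≈ₘ A → IsMoorePenroseInverse A P → P ᵀ ≈ₘ P
    mp-symmetric A-sym mp = mp-unique (mp-resp A-sym (mp-transpose mp)) mp

    -- For symmetric A we have P = A (Pᵀ P); hence P inherits zero column sums from A.
    mp-zeroColumnSums : {A P : Matrix n} → A ᵀ ≈ₘ A → IsMoorePenroseInverse A P →
                        ZeroColumnSums A → ZeroColumnSums P
    mp-zeroColumnSums {A} {P} A-sym (_ , p₂ , _ , p₄) colA k =
      trans (sumℚ-cong (λ i → P≈A⊗PᵀP i k)) (sum-·-zero colA (col (P ᵀ ⊗ P) k))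
      where
        P≈A⊗PᵀP : P ≈ₘ A ⊗ (P ᵀ ⊗ P)
        P≈A⊗PᵀP = begin
          P                    ≈⟨ p₂ ⟨
          (P ⊗ A) ⊗ P          ≈⟨ ⊗-congʳ P p₄ ⟨
          (P ⊗ A) ᵀ ⊗ P        ≈⟨ ⊗-congʳ P (transpose-⊗ P A) ⟩
          (A ᵀ ⊗ P ᵀ) ⊗ P      ≈⟨ ⊗-congʳ P (⊗-congʳ (P ᵀ) A-sym) ⟩
          (A ⊗ P ᵀ) ⊗ P        ≈⟨ ⊗-assoc A (P ᵀ) P ⟩
          A ⊗ (P ᵀ ⊗ P)        ∎

  -- If the diagonal entries a, c are at most f and the binary quadratic form
  -- a + 2 s x + s² c is nonnegative for all s, then |x| ≤ f  (take s = ∓1).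
  off-diagonal-bound : ∀ {a c x f : ℚ} → a ≤ f → c ≤ f →
                       (∀ s → 0ℚ ≤ a + s * (x + x) + s * s * c) → x ≤ f × - x ≤ f
  off-diagonal-bound {a} {c} {x} {f} a≤f c≤f form≥0 =
    bound x (form≥0 (- 1ℚ)) (solve 4 (λ f a c x →
      (f :- a) :+ (f :- c) :+ (a :+ (:- con 1ℚ) :* (x :+ x) :+ (:- con 1ℚ) :* (:- con 1ℚ) :* c)
        := (f :- x) :+ (f :- x)) refl f a c x) ,
    bound (- x) (form≥0 1ℚ) (solve 4 (λ f a c x →
      (f :- a) :+ (f :- c) :+ (a :+ con 1ℚ :* (x :+ x) :+ con 1ℚ :* con 1ℚ :* c)
        := (f :- (:- x)) :+ (f :- (:- x))) refl f a c x)
    where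
      bound : ∀ y {q} → 0ℚ ≤ q → (f - a) + (f - c) + q ≡ (f - y) + (f - y) → y ≤ f
      bound y 0≤q eq = 0≤-⇒≤ (halve-nonneg (subst (0ℚ ≤_) eq
                         (ℚP.+-mono-≤ (ℚP.+-mono-≤ (≤⇒0≤- a≤f) (≤⇒0≤- c≤f)) 0≤q)))

  form : ∀ {n} → Matrix n → (Fin n → ℚ) → (Fin n → ℚ) → ℚ
  form A v w = sumℚ (λ i → v i * (A · w) i)

  module _ {n : ℕ} (A : Matrix n) where

    form-linearˡ : ∀ (v u w : Fin n → ℚ) s → form A (λ i → v i + s * u i) w ≡ form A v w + s * form A u w
    form-linearˡ v u w s = begin
      sumℚ (λ i → (v i + s * u i) * (A · w) i)               ≡⟨ sumℚ-cong (λ i → ℚP.*-distribʳ-+ _ (v i) (s * u i)) ⟩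
      sumℚ (λ i → v i * (A · w) i + s * u i * (A · w) i)     ≡⟨ sumℚ-+ (λ i → v i * (A · w) i) (λ i → s * u i * (A · w) i) ⟩
      form A v w + sumℚ (λ i → s * u i * (A · w) i)
        ≡⟨ cong (form A v w +_) (trans (sumℚ-cong (λ i → ℚP.*-assoc s (u i) _)) (sumℚ-*ˡ s (λ i → u i * (A · w) i))) ⟩
      form A v w + s * form A u w                            ∎
      where open ≡-Reasoning

    form-linearʳ : ∀ (v w u : Fin n → ℚ) s → form A v (λ i → w i + s * u i) ≡ form A v w + s * form A v u
    form-linearʳ v w u s = begin
      sumℚ (λ i → v i * (A · (λ j → w j + s * u j)) i)        ≡⟨ sumℚ-cong (λ i → cong (v i *_) (·-linear A w u s i)) ⟩
      sumℚ (λ i → v i * ((A · w) i + s * (A · u) i))          ≡⟨ sumℚ-cong (λ i → distribute (v i) _ _) ⟩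
      sumℚ (λ i → v i * (A · w) i + s * (v i * (A · u) i))    ≡⟨ sumℚ-+ (λ i → v i * (A · w) i) (λ i → s * (v i * (A · u) i)) ⟩
      form A v w + sumℚ (λ i → s * (v i * (A · u) i))         ≡⟨ cong (form A v w +_) (sumℚ-*ˡ s (λ i → v i * (A · u) i)) ⟩
      form A v w + s * form A v u                             ∎
      where
        open ≡-Reasoning
        distribute : ∀ a x y → a * (x + s * y) ≡ a * x + s * (a * y)
        distribute a x y = solve 4 (λ a x y s → a :* (x :+ s :* y) := a :* x :+ s :* (a :* y)) refl a x y s

    form-expand : ∀ (v u : Fin n → ℚ) s →
      form A (λ i → v i + s * u i) (λ i → v i + s * u i)
        ≡ form A v v + s * (form A v u + form A u v) + s * s * form A u u
    form-expand v u s = begin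
      form A w w                                                  ≡⟨ form-linearˡ v u w s ⟩
      form A v w + s * form A u w
        ≡⟨ cong₂ (λ p q → p + s * q) (form-linearʳ v v u s) (form-linearʳ u v u s) ⟩
      (form A v v + s * form A v u) + s * (form A u v + s * form A u u)
        ≡⟨ solve 5 (λ s a b c d → (a :+ s :* b) :+ s :* (c :+ s :* d) := a :+ s :* (b :+ c) :+ s :* s :* d)
                 refl s (form A v v) (form A v u) (form A u v) (form A u u) ⟩
      form A v v + s * (form A v u + form A u v) + s * s * form A u u  ∎
      where
        open ≡-Reasoning
        w = λ i → v i + s * u i

  -- For a symmetric Moore–Penrose inverse P of A the Gram matrix of the columns
  -- of P with respect to ⟨·, A ·⟩ is P itself:  Pᵀ A P = P A P = P.
  mp-gram : ∀ {n} {A P : Matrix n} → P ᵀ ≈ₘ P → IsMoorePenroseInverse A P →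
            ∀ x y → form A (col P x) (col P y) ≡ P x y
  mp-gram {n} {A} {P} P-sym (_ , p₂ , _ , _) x y = begin
    sumℚ (λ i → P i x * (A ⊗ P) i y)   ≡⟨ sumℚ-cong (λ i → cong (_* (A ⊗ P) i y) (P-sym x i)) ⟩
    (P ⊗ (A ⊗ P)) x y                  ≡⟨ ⊗-assoc P A P x y ⟨
    ((P ⊗ A) ⊗ P) x y                  ≡⟨ p₂ x y ⟩
    P x y                              ∎
    where open ≡-Reasoning

  mp-entry-bound : ∀ {n} {A P : Matrix n} {f : ℚ} → A ᵀ ≈ₘ A → (∀ v → 0ℚ ≤ form A v v) →
                   IsMoorePenroseInverse A P → (∀ i → P i i ≤ f) → ∀ k l → P k l ≤ f × - P k l ≤ f
  mp-entry-bound {n} {A} {P} A-sym A-psd mp diag≤f k l =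
    off-diagonal-bound (diag≤f k) (diag≤f l) form≥0
    where
      P-sym = mp-symmetric A-sym mp
      gram = mp-gram P-sym mp
      form≥0 : ∀ s → 0ℚ ≤ P k k + s * (P k l + P k l) + s * s * P l l
      form≥0 s = subst (0ℚ ≤_) eq (A-psd w)
        where
          w : Fin n → ℚ
          w i = P i k + s * P i l
          gram-lk : form A (col P l) (col P k) ≡ P k l
          gram-lk = trans (gram l k) (P-sym k l)
          Bkk = form A (col P k) (col P k)
          Bkl = form A (col P k) (col P l)
          Bll = form A (col P l) (col P l)
          eq = begin
            form A w w                                          ≡⟨ form-expand A (col P k) (col P l) s ⟩
            Bkk + s * (Bkl + form A (col P l) (col P k)) + s * s * Bll
              ≡⟨ cong₂ (λ a b → a + s * b + s * s * Bll) (gram k k) (cong₂ _+_ (gram k l) gram-lk) ⟩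
            P k k + s * (P k l + P k l) + s * s * Bll          ≡⟨ cong (λ c → P k k + s * (P k l + P k l) + s * s * c) (gram l l) ⟩
            P k k + s * (P k l + P k l) + s * s * P l l        ∎
            where open ≡-Reasoning

  maximum-attained : ∀ {n} (z : Fin n → ℚ) → Fin n → ∃[ m ] (∀ j → z j ≤ z m)
  maximum-attained {n} z i = argmax z i (allFin n) , λ j → All.lookup (f[xs]≤f[argmax] i (allFin n)) (∈-allFin j)

  module _ {n : ℕ} (G : SimpleGraph n) where

    private
      L : Matrix n
      L = laplacian G

    sum-neighbours-const : ∀ i c → sumℚ (λ j → if adj G i j then c else 0ℚ) ≡ ι (deg G i) * c
    sum-neighbours-const i c = begin
      sumℚ (λ j → if adj G i j then c else 0ℚ)          ≡⟨ sumℚ-cong indicator ⟩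
      sumℚ (λ j → ι (if adj G i j then 1 else 0) * c)   ≡⟨ sumℚ-*ʳ c (λ j → ι (if adj G i j then 1 else 0)) ⟩
      sumℚ (λ j → ι (if adj G i j then 1 else 0)) * c   ≡⟨ cong (_* c) (ι-sum (λ j → if adj G i j then 1 else 0)) ⟨
      ι (deg G i) * c                                   ∎
      where
        open ≡-Reasoning
        indicator : ∀ j → (if adj G i j then c else 0ℚ) ≡ ι (if adj G i j then 1 else 0) * c
        indicator j with adj G i j
        ... | true  = sym (ℚP.*-identityˡ c)
        ... | false = sym (ℚP.*-zeroˡ c)

    laplacian-symmetric : L ᵀ ≈ₘ L
    laplacian-symmetric i j with i ≟ j | j ≟ i
    ... | yes refl | yes _    = refl
    ... | yes i≡j  | no  j≢i  = ⊥-elim (j≢i (sym i≡j))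
    ... | no  i≢j  | yes j≡i  = ⊥-elim (i≢j (sym j≡i))
    ... | no  _    | no  _    rewrite symmetric G i j = refl

    laplacian-row : ∀ v u → (L · v) u ≡ sumℚ (λ j → if adj G u j then v u - v j else 0ℚ)
    laplacian-row v u = begin
      (L · v) u                                         ≡⟨ sumℚ-cong entry ⟩
      sumℚ (λ j → diagonal j - neighbour j)             ≡⟨ sumℚ-- diagonal neighbour ⟩
      sumℚ diagonal - sumℚ neighbour                    ≡⟨ cong (_- sumℚ neighbour) (sumℚ-select u (λ _ → ι (deg G u) * v u)) ⟩
      ι (deg G u) * v u - sumℚ neighbour                ≡⟨ cong (_- sumℚ neighbour) (sum-neighbours-const u (v u)) ⟨
      sumℚ centre - sumℚ neighbour                      ≡⟨ sumℚ-- centre neighbour ⟨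
      sumℚ (λ j → centre j - neighbour j)               ≡⟨ sumℚ-cong difference ⟩
      sumℚ (λ j → if adj G u j then v u - v j else 0ℚ)  ∎
      where
        open ≡-Reasoning
        diagonal neighbour centre : Fin n → ℚ
        diagonal  j = if does (u ≟ j) then ι (deg G u) * v u else 0ℚ
        neighbour j = if adj G u j then v j else 0ℚ
        centre    j = if adj G u j then v u else 0ℚ
        entry : ∀ j → L u j * v j ≡ diagonal j - neighbour j
        entry j with u ≟ j
        ... | yes refl rewrite loopless G u = sym (ℚP.+-identityʳ _)
        ... | no  _ with adj G u j
        ...   | true  = solve 1 (λ x → (:- con 1ℚ) :* x := con 0ℚ :- x) refl (v j)
        ...   | false = ℚP.*-zeroˡ (v j)
        difference : ∀ j → centre j - neighbour j ≡ (if adj G u j then v u - v j else 0ℚ)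
        difference j with adj G u j
        ... | true  = refl
        ... | false = ℚP.+-inverseʳ 0ℚ

    -- Constant vectors lie in the kernel of L, so by symmetry its columns sum to zero.
    laplacian-zeroColumnSums : ZeroColumnSums L
    laplacian-zeroColumnSums k = begin
      sumℚ (λ i → L i k)
        ≡⟨ sumℚ-cong (λ i → trans (laplacian-symmetric k i) (sym (ℚP.*-identityʳ (L k i)))) ⟩
      (L · (λ _ → 1ℚ)) k                                ≡⟨ laplacian-row (λ _ → 1ℚ) k ⟩
      sumℚ (λ j → if adj G k j then 1ℚ - 1ℚ else 0ℚ)   ≡⟨ sum-neighbours-const k (1ℚ - 1ℚ) ⟩
      ι (deg G k) * (1ℚ - 1ℚ)                          ≡⟨ ℚP.*-zeroʳ (ι (deg G k)) ⟩
      0ℚ                                                ∎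
      where open ≡-Reasoning

    laplacian-energy : ∀ v → form L v v + form L v v
                             ≡ sumℚ (λ i → sumℚ (λ j → if adj G i j then (v i - v j) * (v i - v j) else 0ℚ))
    laplacian-energy v = begin
      form L v v + form L v v                               ≡⟨ cong₂ _+_ half-energy (trans half-energy (sumℚ-swap term)) ⟩
      sumℚ (λ i → sumℚ (term i)) + sumℚ (λ i → sumℚ (λ j → term j i))
        ≡⟨ sumℚ-+ (λ i → sumℚ (term i)) (λ i → sumℚ (λ j → term j i)) ⟨
      sumℚ (λ i → sumℚ (term i) + sumℚ (λ j → term j i))  ≡⟨ sumℚ-cong (λ i → sumℚ-+ (term i) (λ j → term j i)) ⟨
      sumℚ (λ i → sumℚ (λ j → term i j + term j i))       ≡⟨ sumℚ-cong (λ i → sumℚ-cong (λ j → symmetrise i j)) ⟩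
      sumℚ (λ i → sumℚ (λ j → if adj G i j then (v i - v j) * (v i - v j) else 0ℚ))  ∎
      where
        open ≡-Reasoning
        term : Fin n → Fin n → ℚ
        term i j = if adj G i j then v i * (v i - v j) else 0ℚ
        half-energy : form L v v ≡ sumℚ (λ i → sumℚ (term i))
        half-energy = sumℚ-cong λ i → begin
          v i * (L · v) i                                             ≡⟨ cong (v i *_) (laplacian-row v i) ⟩
          v i * sumℚ (λ j → if adj G i j then v i - v j else 0ℚ)      ≡⟨ sumℚ-*ˡ (v i) (λ j → if adj G i j then v i - v j else 0ℚ) ⟨
          sumℚ (λ j → v i * (if adj G i j then v i - v j else 0ℚ))    ≡⟨ sumℚ-cong (scale i) ⟩
          sumℚ (term i)                                               ∎
          where
            scale : ∀ i j → v i * (if adj G i j then v i - v j else 0ℚ) ≡ term i j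
            scale i j with adj G i j
            ... | true  = refl
            ... | false = ℚP.*-zeroʳ (v i)
        symmetrise : ∀ i j → term i j + term j i ≡ (if adj G i j then (v i - v j) * (v i - v j) else 0ℚ)
        symmetrise i j rewrite symmetric G j i with adj G i j
        ... | true  = solve 2 (λ a b → a :* (a :- b) :+ b :* (b :- a) := (a :- b) :* (a :- b)) refl (v i) (v j)
        ... | false = refl

    laplacian-psd : ∀ v → 0ℚ ≤ form L v v
    laplacian-psd v = halve-nonneg (subst (0ℚ ≤_) (sym (laplacian-energy v))
                                    (sumℚ-nonneg (λ i → sumℚ-nonneg (λ j → square-term i j))))
      where
        square-term : ∀ i j → 0ℚ ≤ (if adj G i j then (v i - v j) * (v i - v j) else 0ℚ)
        square-term i j with adj G i j
        ... | true  = square-nonneg (v i - v j)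
        ... | false = ℚP.≤-refl

    harmonic-max-neighbour : ∀ {z i j} → (∀ u → (L · z) u ≡ 0ℚ) → (∀ k → z k ≤ z i) →
                             adj G i j ≡ true → z j ≡ z i
    harmonic-max-neighbour {z} {i} {j} harmonic max i~j =
      sym (-≡0⇒≡ (subst (λ b → (if b then z i - z j else 0ℚ) ≡ 0ℚ) i~j (terms-vanish j)))
      where
        term≥0 : ∀ k → 0ℚ ≤ (if adj G i k then z i - z k else 0ℚ)
        term≥0 k with adj G i k
        ... | true  = ≤⇒0≤- (max k)
        ... | false = ℚP.≤-refl
        terms-vanish = sumℚ-nonneg-zero term≥0 (trans (sym (laplacian-row z i)) (harmonic i))

    harmonic-max-reach : ∀ {z i k} → (∀ u → (L · z) u ≡ 0ℚ) → (∀ j → z j ≤ z i) →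
                         Reachable G i k → z k ≡ z i
    harmonic-max-reach harmonic max here = refl
    harmonic-max-reach {z} harmonic max (step i~j j⇝k) = trans (harmonic-max-reach harmonic max′ j⇝k) zj≡zi
      where
        zj≡zi = harmonic-max-neighbour harmonic max i~j
        max′ = λ t → subst (z t ≤_) (sym zj≡zi) (max t)

    harmonic-constant : Connected G → ∀ {z} → (∀ u → (L · z) u ≡ 0ℚ) → ∀ i k → z i ≡ z k
    harmonic-constant connected {z} harmonic i k =
      trans (harmonic-max-reach harmonic max (connected m i)) (sym (harmonic-max-reach harmonic max (connected m k)))
      where
        m   = proj₁ (maximum-attained z i)
        max = proj₂ (maximum-attained z i)

  fireCount : ∀ {n} → Fin n → List (Fin n) → ℕ
  fireCount j []       = 0
  fireCount j (i ∷ is) = (if does (i ≟ j) then 1 else 0) ℕ.+ fireCount j is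

  firingVector : ∀ {n} → List (Fin n) → Fin n → ℚ
  firingVector is j = ι (fireCount j is)

  firingVector-∷ : ∀ {n} (i : Fin n) is j → firingVector (i ∷ is) j ≡ unitVector i j + firingVector is j
  firingVector-∷ i is j with i ≟ j
  ... | yes _ = ι-+ 1 (fireCount j is)
  ... | no  _ = sym (ℚP.+-identityˡ _)

  length-firingVector : ∀ {n} (is : List (Fin n)) → ι (length is) ≡ sumℚ (firingVector is)
  length-firingVector {n} [] = sym (sumℚ-zero {n})
  length-firingVector (i ∷ is) = begin
    ι (1 ℕ.+ length is)                                   ≡⟨ ι-+ 1 (length is) ⟩
    1ℚ + ι (length is)                                    ≡⟨ cong₂ _+_ (sym (sumℚ-select i (λ _ → 1ℚ))) (length-firingVector is) ⟩
    sumℚ (unitVector i) + sumℚ (firingVector is)          ≡⟨ sumℚ-+ (unitVector i) (firingVector is) ⟨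
    sumℚ (λ j → unitVector i j + firingVector is j)       ≡⟨ sumℚ-cong (firingVector-∷ i is) ⟨
    sumℚ (firingVector (i ∷ is))                          ∎
    where open ≡-Reasoning

  module _ {n : ℕ} (G : SimpleGraph n) where

    private
      L : Matrix n
      L = laplacian G

    fire-laplacian : ∀ {i a} → deg G i ℕ.≤ a i → ∀ u → ι (fire G i a u) ≡ ι (a u) - L u i
    fire-laplacian {i} {a} ready u with u ≟ i
    ... | yes refl = begin
      ι (a u ℕ.∸ deg G u)                         ≡⟨ solve 2 (λ x d → x := (x :+ d) :- d) refl _ (ι (deg G u)) ⟩
      ι (a u ℕ.∸ deg G u) + ι (deg G u) - ι (deg G u)  ≡⟨ cong (_- ι (deg G u)) (ι-+ (a u ℕ.∸ deg G u) (deg G u)) ⟨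
      ι (a u ℕ.∸ deg G u ℕ.+ deg G u) - ι (deg G u)    ≡⟨ cong (λ m → ι m - ι (deg G u)) (ℕP.m∸n+n≡m ready) ⟩
      ι (a u) - ι (deg G u)                       ∎
      where open ≡-Reasoning
    ... | no _ rewrite symmetric G i u with adj G u i
    ...   | true  = trans (ι-+ 1 (a u)) (solve 1 (λ x → con 1ℚ :+ x := x :- (:- con 1ℚ)) refl (ι (a u)))
    ...   | false = sym (ℚP.+-identityʳ (ι (a u)))

    conservation : ∀ {a is b} → Legal G a is b → ∀ u → ι (a u) ≡ ι (b u) + (L · firingVector is) u
    conservation {a} done u = begin
      ι (a u)                          ≡⟨ ℚP.+-identityʳ (ι (a u)) ⟨
      ι (a u) + 0ℚ                     ≡⟨ cong (ι (a u) +_) (trans (sumℚ-cong (λ j → ℚP.*-zeroʳ (L u j))) (sumℚ-zero {n})) ⟨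
      ι (a u) + (L · firingVector []) u ∎
      where open ≡-Reasoning
    conservation {a} {i ∷ is} {b} (fireStep ready rest) u = begin
      ι (a u)                                                  ≡⟨ solve 2 (λ x y → x := (x :- y) :+ y) refl (ι (a u)) (L u i) ⟩
      (ι (a u) - L u i) + L u i                                ≡⟨ cong (_+ L u i) (fire-laplacian ready u) ⟨
      ι (fire G i a u) + L u i                                 ≡⟨ cong (_+ L u i) (conservation rest u) ⟩
      ι (b u) + (L · firingVector is) u + L u i
        ≡⟨ solve 3 (λ b x l → b :+ x :+ l := b :+ (l :+ x)) refl (ι (b u)) _ (L u i) ⟩
      ι (b u) + (L u i + (L · firingVector is) u)              ≡⟨ cong (λ t → ι (b u) + (t + (L · firingVector is) u)) (·-unit L i u) ⟨
      ι (b u) + ((L · unitVector i) u + (L · firingVector is) u)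
        ≡⟨ cong (ι (b u) +_) (·-+ L (unitVector i) (firingVector is) u) ⟨
      ι (b u) + (L · (λ j → unitVector i j + firingVector is j)) u
        ≡⟨ cong (ι (b u) +_) (·-cong L (firingVector-∷ i is) u) ⟨
      ι (b u) + (L · firingVector (i ∷ is)) u                  ∎
      where open ≡-Reasoning

    starved-vertex-unstable : ∀ {a is b i} → Legal G a is b → fireCount i is ≡ 0 →
                              (∀ j → adj G i j ≡ true → 1 ℕ.≤ fireCount j is) → deg G i ℕ.≤ b i
    starved-vertex-unstable {a} {is} {b} {i} legal idle neighbours-fire = ι-cancel-≤ (begin
      ι (deg G i)                                             ≡⟨ trans (sym (ℚP.*-identityʳ _)) (sym (sum-neighbours-const G i 1ℚ)) ⟩
      sumℚ (λ j → if adj G i j then 1ℚ else 0ℚ)               ≤⟨ sumℚ-mono received ⟩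
      sumℚ (λ j → - (if adj G i j then x i - x j else 0ℚ))    ≡⟨ sumℚ-neg (λ j → if adj G i j then x i - x j else 0ℚ) ⟩
      - sumℚ (λ j → if adj G i j then x i - x j else 0ℚ)      ≡⟨ cong -_ (laplacian-row G x i) ⟨
      - (L · x) i                                             ≡⟨ ℚP.+-identityˡ _ ⟨
      0ℚ - (L · x) i                                          ≤⟨ ℚP.+-monoˡ-≤ (- (L · x) i) (ι-nonneg (a i)) ⟩
      ι (a i) - (L · x) i                                     ≡⟨ cong (_- (L · x) i) (conservation legal i) ⟩
      ι (b i) + (L · x) i - (L · x) i                         ≡⟨ solve 2 (λ b y → b :+ y :- y := b) refl (ι (b i)) ((L · x) i) ⟩
      ι (b i)                                                 ∎)
      where
        open ℚP.≤-Reasoning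
        x = firingVector is
        received : ∀ j → (if adj G i j then 1ℚ else 0ℚ) ≤ - (if adj G i j then x i - x j else 0ℚ)
        received j with adj G i j in i~j
        ... | true  = subst (1ℚ ≤_) gain (ι-mono (neighbours-fire j i~j))
          where gain : x j ≡ - (x i - x j)
                gain = trans (solve 1 (λ y → y := :- (con 0ℚ :- y)) refl (x j)) (cong (λ t → - (ι t - x j)) (sym idle))
        ... | false = ℚP.≤-refl

    -- In a terminating game on a nonempty graph some vertex never fires:
    -- otherwise consider the first firing i; afterwards i never fires but all
    -- its neighbours do, so i cannot be stable at the end.
    idle-vertex : ∀ {a is b} → Legal G a is b → Stable G b → Fin n → ∃[ k ] fireCount k is ≡ 0
    idle-vertex done _ v = v , refl
    idle-vertex {a} {i ∷ is} {b} (fireStep _ rest) stable v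
      with FinP.any? (λ k → ¬? (i ≟ k) ×-dec (fireCount k is ℕP.≟ 0))
    ... | yes (k , i≢k , idle) = k , idle-after-first
      where
        idle-after-first : fireCount k (i ∷ is) ≡ 0
        idle-after-first with i ≟ k
        ... | yes i≡k = ⊥-elim (i≢k i≡k)
        ... | no  _   = idle
    ... | no none = ⊥-elim (ℕP.<⇒≱ (stable i) (starved-vertex-unstable rest i-idle neighbours-fire))
      where
        i-idle : fireCount i is ≡ 0
        i-idle with idle-vertex rest stable v
        ... | k , idle with i ≟ k
        ...   | yes refl = idle
        ...   | no  i≢k  = ⊥-elim (none (k , i≢k , idle))
        neighbours-fire : ∀ j → adj G i j ≡ true → 1 ℕ.≤ fireCount j is
        neighbours-fire j i~j with i ≟ j
        ... | yes refl with trans (sym i~j) (loopless G i)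
        ...   | ()
        neighbours-fire j i~j | no i≢j with fireCount j is ℕP.≟ 0
        ...   | yes idle = ⊥-elim (none (j , i≢j , idle))
        ...   | no  busy = ℕP.n≢0⇒n>0 busy

    -- Chips are conserved (in ℚ), as the columns of L sum to zero.
    chips-conserved : ∀ {a is b} → Legal G a is b → ι (chips b) ≡ ι (chips a)
    chips-conserved {a} {is} {b} legal = begin
      ι (chips b)                                      ≡⟨ ι-sum b ⟩
      sumℚ (λ u → ι (b u))                             ≡⟨ ℚP.+-identityʳ _ ⟨
      sumℚ (λ u → ι (b u)) + 0ℚ
        ≡⟨ cong (sumℚ (λ u → ι (b u)) +_) (sum-·-zero (laplacian-zeroColumnSums G) (firingVector is)) ⟨
      sumℚ (λ u → ι (b u)) + sumℚ (L · firingVector is) ≡⟨ sumℚ-+ (λ u → ι (b u)) (L · firingVector is) ⟨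
      sumℚ (λ u → ι (b u) + (L · firingVector is) u)   ≡⟨ sumℚ-cong (conservation legal) ⟨
      sumℚ (λ u → ι (a u))                             ≡⟨ ι-sum a ⟨
      ι (chips a)                                      ∎
      where open ≡-Reasoning

  module _ {n : ℕ} {G : SimpleGraph n} (connected : Connected G)
           {P : Matrix n} (mp : IsMoorePenroseInverse (laplacian G) P) where

    private
      L : Matrix n
      L = laplacian G

    mp-solves-poisson : ∀ x u → (L · (P · (L · x))) u ≡ (L · x) u
    mp-solves-poisson x u = begin
      (L · (P · (L · x))) u      ≡⟨ ·-cong L (λ j → ·-⊗ P L x j) u ⟩
      (L · ((P ⊗ L) · x)) u      ≡⟨ ·-⊗ L (P ⊗ L) x u ⟩
      ((L ⊗ (P ⊗ L)) · x) u      ≡⟨ sumℚ-cong (λ j → cong (_* x j) (trans (sym (⊗-assoc L P L u j)) (proj₁ mp u j))) ⟩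
      (L · x) u                  ∎
      where open ≡-Reasoning

    -- On a connected graph x − P L x is harmonic, hence constant; so a vector
    -- vanishing at k is recovered from its Laplacian as x j = y j − y k.
    recover-from-laplacian : ∀ x k → x k ≡ 0ℚ → ∀ j → x j ≡ (P · (L · x)) j - (P · (L · x)) k
    recover-from-laplacian x k xk≡0 j = begin
      x j                        ≡⟨ solve 2 (λ x y → x := (x :- y) :+ y) refl (x j) (y j) ⟩
      (x j - y j) + y j          ≡⟨ cong (_+ y j) (harmonic-constant G connected harmonic j k) ⟩
      (x k - y k) + y j          ≡⟨ cong (λ t → (t - y k) + y j) xk≡0 ⟩
      (0ℚ - y k) + y j           ≡⟨ solve 2 (λ a b → (con 0ℚ :- a) :+ b := b :- a) refl (y k) (y j) ⟩
      y j - y k                  ∎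
      where
        open ≡-Reasoning
        y = P · (L · x)
        harmonic : ∀ u → (L · (λ i → x i - y i)) u ≡ 0ℚ
        harmonic u = trans (·-sub L x y u) (trans (cong (λ t → (L · x) u - t) (mp-solves-poisson x u)) (ℚP.+-inverseʳ ((L · x) u)))

    -- Summing, and using that the entries of P v sum to zero.
    sum-from-laplacian : ∀ x k → x k ≡ 0ℚ → sumℚ x ≡ ι n * - (P · (L · x)) k
    sum-from-laplacian x k xk≡0 = begin
      sumℚ x                                 ≡⟨ sumℚ-cong (recover-from-laplacian x k xk≡0) ⟩
      sumℚ (λ j → y j - y k)                 ≡⟨ sumℚ-- y (λ _ → y k) ⟩
      sumℚ y - sumℚ {n} (λ _ → y k)          ≡⟨ cong₂ _-_ Σy≡0 (sumℚ-const {n} (y k)) ⟩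
      0ℚ - ι n * y k                         ≡⟨ solve 2 (λ m a → con 0ℚ :- m :* a := m :* (:- a)) refl (ι n) (y k) ⟩
      ι n * - y k                            ∎
      where
        open ≡-Reasoning
        y = P · (L · x)
        P-columns = mp-zeroColumnSums (laplacian-symmetric G) mp (laplacian-zeroColumnSums G)
        Σy≡0 = sum-·-zero P-columns (L · x)

  row-bound : ∀ {n} {P : Matrix n} {f : ℚ} k → (∀ l → P k l ≤ f × - P k l ≤ f) →
              ∀ (p q : Fin n → ℚ) → (∀ l → 0ℚ ≤ p l) → (∀ l → 0ℚ ≤ q l) →
              - (P · (λ l → p l - q l)) k ≤ f * (sumℚ p + sumℚ q)
  row-bound {n} {P} {f} k entry≤f p q p≥0 q≥0 = begin
    - sumℚ (λ l → P k l * (p l - q l))            ≡⟨ sumℚ-neg (λ l → P k l * (p l - q l)) ⟨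
    sumℚ (λ l → - (P k l * (p l - q l)))          ≤⟨ sumℚ-mono term-bound ⟩
    sumℚ (λ l → f * (p l + q l))                  ≡⟨ sumℚ-*ˡ f (λ l → p l + q l) ⟩
    f * sumℚ (λ l → p l + q l)                    ≡⟨ cong (f *_) (sumℚ-+ p q) ⟩
    f * (sumℚ p + sumℚ q)                         ∎
    where
      open ℚP.≤-Reasoning
      term-bound : ∀ l → - (P k l * (p l - q l)) ≤ f * (p l + q l)
      term-bound l = subst₂ _≤_
        (solve 3 (λ a x y → (:- a) :* x :+ a :* y := :- (a :* (x :- y))) refl (P k l) (p l) (q l))
        (sym (ℚP.*-distribˡ-+ f (p l) (q l)))
        (ℚP.+-mono-≤ (ℚP.*-monoʳ-≤-nonNeg (p l) {{nonNegative (p≥0 l)}} (proj₂ (entry≤f l)))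
                     (ℚP.*-monoʳ-≤-nonNeg (q l) {{nonNegative (q≥0 l)}} (proj₁ (entry≤f l))))

  terminating-game-bound : ∀ {n} (G : SimpleGraph n) → Connected G →
    ∀ {a firings} → TerminatingGame G a firings →
    ∀ {P} → IsMoorePenroseInverse (laplacian G) P → ∀ {f} → IsMaxDiag P f →
    ι (length firings) ≤ ι (2 ℕ.* n ℕ.* chips a) * f
  terminating-game-bound {zero} G _ {firings = []} _ _ {f = f} _ = ℚP.≤-reflexive (sym (ℚP.*-zeroˡ f))
  terminating-game-bound {zero} G _ {firings = () ∷ _} _ _ _
  terminating-game-bound {suc m} G connected {a} {firings} (b , legal , stable) {P} mp {f} (_ , diag≤f) = begin
    ι (length firings)                                  ≡⟨ length-firingVector firings ⟩
    sumℚ x                                              ≡⟨ sum-from-laplacian connected mp x k (cong ι idle) ⟩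
    ι n * - (P · (L · x)) k                             ≡⟨ cong (λ t → ι n * - t) (·-cong P Lx≡a-b k) ⟩
    ι n * - (P · (λ u → ι (a u) - ι (b u))) k           ≤⟨ ℚP.*-monoˡ-≤-nonNeg (ι n) {{nonNegative (ι-nonneg n)}}
                                                             (row-bound {P = P} k entry-bound (ι ∘ a) (ι ∘ b) (ι-nonneg ∘ a) (ι-nonneg ∘ b)) ⟩
    ι n * (f * (sumℚ (ι ∘ a) + sumℚ (ι ∘ b)))           ≡⟨ cong (λ t → ι n * (f * t)) total-chips ⟩
    ι n * (f * (ι N + ι N))                             ≡⟨ solve 3 (λ m f c → m :* (f :* (c :+ c)) := (con 1ℚ :+ con 1ℚ) :* m :* c :* f)
                                                                 refl (ι n) f (ι N) ⟩
    (1ℚ + 1ℚ) * ι n * ι N * f                           ≡⟨ cong (_* f) (trans (ι-* (2 ℕ.* n) N) (cong (_* ι N) (ι-* 2 n))) ⟨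
    ι (2 ℕ.* n ℕ.* N) * f                               ∎
    where
      open ℚP.≤-Reasoning
      n = suc m
      N = chips a
      L = laplacian G
      x = firingVector firings
      k    = proj₁ (idle-vertex G legal stable zero)
      idle = proj₂ (idle-vertex G legal stable zero)
      Lx≡a-b : ∀ u → (L · x) u ≡ ι (a u) - ι (b u)
      Lx≡a-b u = trans (solve 2 (λ y c → y := (c :+ y) :- c) refl ((L · x) u) (ι (b u)))
                       (cong (_- ι (b u)) (sym (conservation G legal u)))
      entry-bound = mp-entry-bound (laplacian-symmetric G) (laplacian-psd G) mp diag≤f k
      total-chips : sumℚ (ι ∘ a) + sumℚ (ι ∘ b) ≡ ι N + ι N
      total-chips = cong₂ _+_ (sym (ι-sum a)) (trans (sym (ι-sum b)) (chips-conserved G legal))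

open ChipFiringBound using (terminating-game-bound)

open import Data.Nat using (ℕ; _*_)
open import Data.Fin using (Fin)
open import Data.List using (List; length)
open import Data.Integer using (+_)
open import Data.Rational using (ℚ; _/_; _≤_) renaming (_*_ to _*ℚ_)

mainTheorem3 : ∀ (n : ℕ) (G : SimpleGraph n) → Connected G →
    (a : Config n) (firings : List (Fin n)) → TerminatingGame G a firings →
    (Ldag : Matrix n) → IsMoorePenroseInverse (laplacian G) Ldag →
    (f : ℚ) → IsMaxDiag Ldag f →
    (+ length firings) / 1 ≤ ((+ (2 * n * chips a)) / 1) *ℚ f
mainTheorem3 n G connected a firings game Ldag isMoorePenrose f isMaxDiag =
  terminating-game-bound G connected game isMoorePenrose isMaxDiag
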